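{- Let $A$ be the adjacency matrix of a simple graph $\Gamma$ with vertex set $V$. Then $$-1+\min_{\varnothing\ne S\subseteq V}\big(|S|+|\mathrm{Odd}(S)|\big)\le rk_2(A),$$ where $rk_2(A)$ is the rank of $A$ over $\mathbb{F}_2$.
   Context: $N(v)$ denotes the set of neighbors of $v$ in $\Gamma$, and for nonempty $S\subseteq V$, $\mathrm{Odd}(S)=\{v\in V : |N(v)\cap S| \text{ is odd}\}$. -}

module Defs where

open import Data.Nat using (ℕ; zero; suc; _≤_)
open import Data.Bool using (Bool; true; false; _∧_; _xor_)
open import Data.Fin using (Fin; zero; suc)
open import Data.Fin.Subset using (Subset)
open import Data.Vec using (tabulate; lookup)
open import Data.Product using (Σ; _×_; ∃-syntax)
open import Relation.Binary.PropositionalEquality using (_≡_)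
open import Relation.Nullary using (¬_)

-- Elements of 𝔽₂ are represented by Bool (false = 0, true = 1);
-- addition is xor, multiplication is ∧.

Σ₂ : ∀ {k} → (Fin k → Bool) → Bool
Σ₂ {zero}  f = false
Σ₂ {suc k} f = f zero xor Σ₂ (λ i → f (suc i))

record SimpleGraph (n : ℕ) : Set where
  field
    adj    : Fin n → Fin n → Bool
    sym    : ∀ u v → adj u v ≡ adj v u
    irrefl : ∀ v → adj v v ≡ false
open SimpleGraph public

-- Odd(S) = { v ∈ V : |N(v) ∩ S| is odd }; the parity of |N(v) ∩ S| is the
-- 𝔽₂-sum over u of [u ∈ N(v)] ∧ [u ∈ S].
Odd : ∀ {n} → SimpleGraph n → Subset n → Subset n
Odd Γ S = tabulate (λ v → Σ₂ (λ u → adj Γ v u ∧ lookup S u))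

LinIndep₂ : ∀ {k n} → (Fin k → Fin n → Bool) → Set
LinIndep₂ {k} {n} v =
  ∀ (c : Fin k → Bool) →
  (∀ (j : Fin n) → Σ₂ (λ i → c i ∧ v i j) ≡ false) →
  ∀ i → c i ≡ false

IsRank₂ : ∀ {m n} → (Fin m → Fin n → Bool) → ℕ → Set
IsRank₂ {m} {n} M r =
  (Σ (Fin r → Fin m) λ ι → LinIndep₂ (λ i → M (ι i))) ×
  (∀ k (ι : Fin k → Fin m) → LinIndep₂ (λ i → M (ι i)) → k ≤ r)

-- If r < n, take r independent rows of A and a vertex v whose row is not among them. By
-- maximality the r + 1 rows are dependent, and independence of the r rows forces the
-- relation Σᵢ cᵢ A_{F i} = 0 to involve row v. The vector S = Σᵢ cᵢ e_{F i} then contains v,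
-- has at most r + 1 elements, and by symmetry of A its parity vector A·S = Σᵢ cᵢ A_{F i}
-- vanishes, i.e. Odd(S) = ∅. If r ≥ n, any singleton works, since |Odd(S)| ≤ n.

module Submission where

open import Defs hiding (sym)
open import Data.Nat using (ℕ; zero; suc; _+_; _≤_; _<_; z≤n; s≤s; _<?_)
open import Data.Nat.Properties
  using (≤-refl; ≤-trans; +-mono-≤; n≤1+n; +-suc; +-identityʳ; ≮⇒≥; <⇒≱; <-irrefl)
open import Data.Bool using (Bool; true; false; _∧_; _xor_)
open import Data.Bool.Properties
  using (∧-comm; ∧-assoc; ∧-zeroʳ; ∧-identityʳ; ∧-distribˡ-xor; xor-identityʳ; xor-∧-commutativeRing)
  renaming (_≟_ to _≟ᵇ_)
open import Data.Fin using (Fin; zero; suc; fromℕ<)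
open import Data.Fin.Properties using (any?; all?; ¬∀⟶∃¬; injective⇒≤) renaming (_≟_ to _≟ᶠ_)
open import Data.Fin.Subset using (Subset; Nonempty; _∈_; ∣_∣; ⁅_⁆; ⊥)
open import Data.Fin.Subset.Properties
  using (anySubset?; ∣⁅x⁆∣≡1; ∣⊥∣≡0; ∣p∣≤n; x∈⁅x⁆; x∈⁅y⁆⇒x≡y)
open import Data.Vec using (tabulate; lookup)
open import Data.Vec.Properties
  using (lookup∘tabulate; tabulate∘lookup; tabulate-cong; lookup-replicate; lookup⇒[]=; []=⇒lookup)
open import Data.Vec.Functional using (_∷_)
open import Data.Product using (_×_; _,_; proj₁; proj₂; ∃-syntax)
open import Function using (_∘_)
open import Relation.Nullary using (¬_; yes; no; contradiction)
open import Relation.Nullary.Decidable using (_×-dec_)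
open import Relation.Binary.PropositionalEquality
  using (_≡_; _≢_; refl; sym; trans; cong; cong₂; module ≡-Reasoning)
open import Algebra.Bundles using (CommutativeRing)
open import Algebra.Properties.CommutativeSemigroup
  (CommutativeRing.+-commutativeSemigroup xor-∧-commutativeRing)
  using () renaming (interchange to xor-interchange)

Σ₂-cong : ∀ {k} {f g : Fin k → Bool} → (∀ i → f i ≡ g i) → Σ₂ f ≡ Σ₂ g
Σ₂-cong {zero}  f≡g = refl
Σ₂-cong {suc k} f≡g = cong₂ _xor_ (f≡g zero) (Σ₂-cong (f≡g ∘ suc))

Σ₂-false : ∀ {k} {f : Fin k → Bool} → (∀ i → f i ≡ false) → Σ₂ f ≡ false
Σ₂-false {zero}  f≡false = refl
Σ₂-false {suc k} f≡false rewrite f≡false zero = Σ₂-false (f≡false ∘ suc)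

Σ₂-xor : ∀ {k} (f g : Fin k → Bool) → Σ₂ (λ i → f i xor g i) ≡ Σ₂ f xor Σ₂ g
Σ₂-xor {zero}  f g = refl
Σ₂-xor {suc k} f g =
  trans (cong ((f zero xor g zero) xor_) (Σ₂-xor (f ∘ suc) (g ∘ suc)))
        (xor-interchange (f zero) (g zero) (Σ₂ (f ∘ suc)) (Σ₂ (g ∘ suc)))

∧-distribˡ-Σ₂ : ∀ {k} a (f : Fin k → Bool) → a ∧ Σ₂ f ≡ Σ₂ (λ i → a ∧ f i)
∧-distribˡ-Σ₂ {zero}  a f = ∧-comm a false
∧-distribˡ-Σ₂ {suc k} a f =
  trans (∧-distribˡ-xor a (f zero) (Σ₂ (f ∘ suc)))
        (cong ((a ∧ f zero) xor_) (∧-distribˡ-Σ₂ a (f ∘ suc)))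

Σ₂-comm : ∀ {k m} (h : Fin k → Fin m → Bool) →
          Σ₂ (λ i → Σ₂ (h i)) ≡ Σ₂ (λ j → Σ₂ (λ i → h i j))
Σ₂-comm {zero} {m} h = sym (Σ₂-false {m} (λ _ → refl))
Σ₂-comm {suc k} h =
  trans (cong (Σ₂ (h zero) xor_) (Σ₂-comm (h ∘ suc)))
        (sym (Σ₂-xor (h zero) (λ j → Σ₂ (λ i → h (suc i) j))))

Σ₂-⁅⁆ : ∀ {n} (a : Fin n) (g : Fin n → Bool) → Σ₂ (λ u → lookup ⁅ a ⁆ u ∧ g u) ≡ g a
Σ₂-⁅⁆ zero g =
  trans (cong (g zero xor_) (Σ₂-false (λ u → cong (_∧ g (suc u)) (lookup-replicate u false))))
        (xor-identityʳ (g zero))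
Σ₂-⁅⁆ (suc a) g = Σ₂-⁅⁆ a (g ∘ suc)

IsRelation₂ : ∀ {k n} → (Fin k → Fin n → Bool) → (Fin k → Bool) → Set
IsRelation₂ v c = ∀ j → Σ₂ (λ i → c i ∧ v i j) ≡ false

¬LinIndep₂⇒relation : ∀ {k n} {v : Fin k → Fin n → Bool} → ¬ LinIndep₂ v →
                       ∃[ c ] (IsRelation₂ v c × ∃[ i ] c i ≡ true)
¬LinIndep₂⇒relation {v = v} ¬indep
  with anySubset? (λ s → all? (λ j → Σ₂ (λ i → lookup s i ∧ v i j) ≟ᵇ false)
                         ×-dec any? (λ i → lookup s i ≟ᵇ true))
... | yes (s , rel , nontrivial) = lookup s , rel , nontrivial
... | no ¬relation = contradiction indep ¬indep
  where
  indep : LinIndep₂ v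
  indep c rel i with c i in cᵢ
  ... | false = refl
  ... | true  = contradiction (tabulate c , rel′ , i , trans (lookup∘tabulate c i) cᵢ) ¬relation
    where
    rel′ : IsRelation₂ v (lookup (tabulate c))
    rel′ j = trans (Σ₂-cong (λ i → cong (_∧ v i j) (lookup∘tabulate c i))) (rel j)

relation-head : ∀ {k n} {v : Fin (suc k) → Fin n → Bool} {c : Fin (suc k) → Bool} →
                LinIndep₂ (v ∘ suc) → IsRelation₂ v c → ∀ i → c i ≡ true → c zero ≡ true
relation-head {c = c} indep rel i cᵢ with c zero in c₀
... | true  = refl
... | false = contradiction (trans (sym cᵢ) (tail≡false i)) λ ()
  where
  tail≡false : ∀ i → c i ≡ false
  tail≡false zero    = c₀
  -- matching on c zero has turned rel into a relation among the rows v ∘ suc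
  tail≡false (suc i) = indep (c ∘ suc) rel i

tabulate≡⊥ : ∀ {n} {f : Fin n → Bool} → (∀ u → f u ≡ false) → tabulate f ≡ ⊥
tabulate≡⊥ {n} f≡false =
  trans (tabulate-cong (λ u → trans (f≡false u) (sym (lookup-replicate u false))))
        (tabulate∘lookup (⊥ {n}))

∣tabulate-false∣≡0 : ∀ n → ∣ tabulate {n = n} (λ _ → false) ∣ ≡ 0
∣tabulate-false∣≡0 n = trans (cong ∣_∣ (tabulate≡⊥ {n} (λ _ → refl))) (∣⊥∣≡0 n)

∣tabulate-∧∣≤ : ∀ {n} b (f : Fin n → Bool) → ∣ tabulate (λ u → b ∧ f u) ∣ ≤ ∣ tabulate f ∣
∣tabulate-∧∣≤ true  f = ≤-refl
∣tabulate-∧∣≤ {n} false f rewrite ∣tabulate-false∣≡0 n = z≤n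

∣tabulate-xor∣≤ : ∀ {n} (f g : Fin n → Bool) →
                  ∣ tabulate (λ u → f u xor g u) ∣ ≤ ∣ tabulate f ∣ + ∣ tabulate g ∣
∣tabulate-xor∣≤ {zero}  f g = z≤n
∣tabulate-xor∣≤ {suc n} f g with f zero | g zero | ∣tabulate-xor∣≤ (f ∘ suc) (g ∘ suc)
... | true  | true  | ih = ≤-trans ih (+-mono-≤ (n≤1+n _) (n≤1+n _))
... | true  | false | ih = s≤s ih
... | false | true  | ih rewrite +-suc ∣ tabulate (f ∘ suc) ∣ ∣ tabulate (g ∘ suc) ∣ = s≤s ih
... | false | false | ih = ih

lookup-⁅x⁆-x : ∀ {n} (x : Fin n) → lookup ⁅ x ⁆ x ≡ true
lookup-⁅x⁆-x x = []=⇒lookup (x∈⁅x⁆ x)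

lookup-⁅x⁆-≢ : ∀ {n} {x y : Fin n} → x ≢ y → lookup ⁅ x ⁆ y ≡ false
lookup-⁅x⁆-≢ {x = x} {y} x≢y with lookup ⁅ x ⁆ y in y∈⁅x⁆
... | false = refl
... | true  = contradiction (sym (x∈⁅y⁆⇒x≡y x (lookup⇒[]= y ⁅ x ⁆ y∈⁅x⁆))) x≢y

unitVectorSum : ∀ {k n} → (Fin k → Bool) → (Fin k → Fin n) → Fin n → Bool
unitVectorSum c F u = Σ₂ (λ i → c i ∧ lookup ⁅ F i ⁆ u)

∣unitVectorSum∣≤ : ∀ {k n} (c : Fin k → Bool) (F : Fin k → Fin n) →
                   ∣ tabulate (unitVectorSum c F) ∣ ≤ k
∣unitVectorSum∣≤ {zero}  {n} c F rewrite ∣tabulate-false∣≡0 n = z≤n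
∣unitVectorSum∣≤ {suc k} c F = ≤-trans
  (∣tabulate-xor∣≤ (λ u → c zero ∧ lookup ⁅ F zero ⁆ u) (unitVectorSum (c ∘ suc) (F ∘ suc)))
  (+-mono-≤ head≤1 (∣unitVectorSum∣≤ (c ∘ suc) (F ∘ suc)))
  where
  head≤1 : ∣ tabulate (λ u → c zero ∧ lookup ⁅ F zero ⁆ u) ∣ ≤ 1
  head≤1 rewrite sym (∣⁅x⁆∣≡1 (F zero)) | sym (cong ∣_∣ (tabulate∘lookup ⁅ F zero ⁆)) =
    ∣tabulate-∧∣≤ (c zero) (lookup ⁅ F zero ⁆)

unitVectorSum-∷ : ∀ {k n} (c : Fin (suc k) → Bool) {v : Fin n} {F : Fin k → Fin n} →
                  (∀ i → F i ≢ v) → unitVectorSum c (v ∷ F) v ≡ c zero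
unitVectorSum-∷ c {v} {F} v∉F = begin
  (c zero ∧ lookup ⁅ v ⁆ v) xor Σ₂ (λ i → c (suc i) ∧ lookup ⁅ F i ⁆ v)
    ≡⟨ cong₂ (λ a b → (c zero ∧ a) xor b) (lookup-⁅x⁆-x v)
             (Σ₂-false (λ i → trans (cong (c (suc i) ∧_) (lookup-⁅x⁆-≢ (v∉F i))) (∧-zeroʳ (c (suc i))))) ⟩
  (c zero ∧ true) xor false
    ≡⟨ trans (xor-identityʳ _) (∧-identityʳ (c zero)) ⟩
  c zero ∎
  where open ≡-Reasoning

Σ₂-∧-unitVectorSum : ∀ {k n} (g : Fin n → Bool) (c : Fin k → Bool) (F : Fin k → Fin n) →
                     Σ₂ (λ u → g u ∧ unitVectorSum c F u) ≡ Σ₂ (λ i → c i ∧ g (F i))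
Σ₂-∧-unitVectorSum {k} {n} g c F = begin
  Σ₂ (λ u → g u ∧ Σ₂ (λ i → c i ∧ e i u))
    ≡⟨ Σ₂-cong (λ u → ∧-distribˡ-Σ₂ (g u) (λ i → c i ∧ e i u)) ⟩
  Σ₂ (λ u → Σ₂ (λ i → g u ∧ (c i ∧ e i u)))
    ≡⟨ Σ₂-comm (λ u i → g u ∧ (c i ∧ e i u)) ⟩
  Σ₂ (λ i → Σ₂ (λ u → g u ∧ (c i ∧ e i u)))
    ≡⟨ Σ₂-cong (λ i → Σ₂-cong (λ u → rearrange (g u) (c i) (e i u))) ⟩
  Σ₂ (λ i → Σ₂ (λ u → c i ∧ (e i u ∧ g u)))
    ≡⟨ Σ₂-cong (λ i → sym (∧-distribˡ-Σ₂ (c i) (λ u → e i u ∧ g u))) ⟩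
  Σ₂ (λ i → c i ∧ Σ₂ (λ u → e i u ∧ g u))
    ≡⟨ Σ₂-cong (λ i → cong (c i ∧_) (Σ₂-⁅⁆ (F i) g)) ⟩
  Σ₂ (λ i → c i ∧ g (F i))
    ∎
  where
  open ≡-Reasoning
  e : Fin k → Fin n → Bool
  e i = lookup ⁅ F i ⁆
  rearrange : ∀ x y z → x ∧ (y ∧ z) ≡ y ∧ (z ∧ x)
  rearrange x y z = trans (∧-comm x (y ∧ z)) (∧-assoc y z x)

Odd-unitVectorSum : ∀ {k n} (Γ : SimpleGraph n) (c : Fin k → Bool) (F : Fin k → Fin n) →
                    IsRelation₂ (adj Γ ∘ F) c → Odd Γ (tabulate (unitVectorSum c F)) ≡ ⊥
Odd-unitVectorSum {n = n} Γ c F rel = tabulate≡⊥ λ w → begin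
  Σ₂ (λ u → adj Γ w u ∧ lookup (tabulate s) u)
    ≡⟨ Σ₂-cong (λ u → cong (adj Γ w u ∧_) (lookup∘tabulate s u)) ⟩
  Σ₂ (λ u → adj Γ w u ∧ s u)
    ≡⟨ Σ₂-∧-unitVectorSum (adj Γ w) c F ⟩
  Σ₂ (λ i → c i ∧ adj Γ w (F i))
    ≡⟨ Σ₂-cong (λ i → cong (c i ∧_) (SimpleGraph.sym Γ w (F i))) ⟩
  Σ₂ (λ i → c i ∧ adj Γ (F i) w)
    ≡⟨ rel w ⟩
  false
    ∎
  where
  open ≡-Reasoning
  s : Fin n → Bool
  s = unitVectorSum c F

relation⇒oddFreeSet : ∀ {k n} (Γ : SimpleGraph n) (c : Fin (suc k) → Bool)
                      (v : Fin n) (F : Fin k → Fin n) →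
                      IsRelation₂ (adj Γ ∘ (v ∷ F)) c → c zero ≡ true → (∀ i → F i ≢ v) →
                      ∃[ S ] (Nonempty S × ∣ S ∣ + ∣ Odd Γ S ∣ ≤ suc k)
relation⇒oddFreeSet {k} {n} Γ c v F rel c₀ v∉F = S , (v , v∈S) , ∣S∣+∣OddS∣≤
  where
  S : Subset n
  S = tabulate (unitVectorSum c (v ∷ F))
  v∈S : v ∈ S
  v∈S = lookup⇒[]= v S (trans (lookup∘tabulate _ v) (trans (unitVectorSum-∷ c v∉F) c₀))
  ∣S∣+∣OddS∣≤ : ∣ S ∣ + ∣ Odd Γ S ∣ ≤ suc k
  ∣S∣+∣OddS∣≤ rewrite Odd-unitVectorSum Γ c (v ∷ F) rel | ∣⊥∣≡0 n | +-identityʳ ∣ S ∣ =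
    ∣unitVectorSum∣≤ c (v ∷ F)

∃-∉-image : ∀ {r n} → r < n → (ι : Fin r → Fin n) → ∃[ v ] (∀ i → ι i ≢ v)
∃-∉-image {n = n} r<n ι with all? (λ v → any? (λ i → ι i ≟ᶠ v))
... | yes surjective = contradiction (injective⇒≤ preimage-injective) (<⇒≱ r<n)
  where
  preimage-injective : ∀ {u v} → proj₁ (surjective u) ≡ proj₁ (surjective v) → u ≡ v
  preimage-injective {u} {v} eq =
    trans (sym (proj₂ (surjective u))) (trans (cong ι eq) (proj₂ (surjective v)))
... | no ¬surjective with ¬∀⟶∃¬ n _ (λ v → any? (λ i → ι i ≟ᶠ v)) ¬surjective
...   | v , v∉ι = v , λ i ιᵢ≡v → v∉ι (i , ιᵢ≡v)

∣⁅x⁆∣+∣Odd⁅x⁆∣≤ : ∀ {n} (Γ : SimpleGraph n) (x : Fin n) → ∣ ⁅ x ⁆ ∣ + ∣ Odd Γ ⁅ x ⁆ ∣ ≤ suc n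
∣⁅x⁆∣+∣Odd⁅x⁆∣≤ Γ x rewrite ∣⁅x⁆∣≡1 x = s≤s (∣p∣≤n (Odd Γ ⁅ x ⁆))

mainTheorem7 : ∀ {n : ℕ} (Γ : SimpleGraph n) → 0 < n → ∀ (r : ℕ) → IsRank₂ (adj Γ) r →
                 ∃[ S ] (Nonempty S × ∣ S ∣ + ∣ Odd Γ S ∣ ≤ suc r)
mainTheorem7 {n} Γ 0<n r ((ι , indep) , maximal) with r <? n
... | no r≮n = ⁅ x ⁆ , (x , x∈⁅x⁆ x) , ≤-trans (∣⁅x⁆∣+∣Odd⁅x⁆∣≤ Γ x) (s≤s (≮⇒≥ r≮n))
  where
  x : Fin n
  x = fromℕ< 0<n
... | yes r<n with ∃-∉-image r<n ι
...   | v , v∉ι with ¬LinIndep₂⇒relation {v = adj Γ ∘ (v ∷ ι)} (<-irrefl refl ∘ maximal (suc r) (v ∷ ι))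
...     | c , rel , i , cᵢ =
  relation⇒oddFreeSet Γ c v ι rel (relation-head {v = adj Γ ∘ (v ∷ ι)} {c} indep rel i cᵢ) v∉ι
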